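{- Let $z$ be an arbitrary vertex of a $\mathcal{T}_7$-free tournament $T'$ and let $i\ge 3$. If $V_i(z)$ is 2-in-dominated by $V_{i-1}(z)$, then the subtournament induced by $V_i(z)$ is $\mathcal{T}_5$-free.
   Context: A tournament is an orientation of a complete graph; $u\to v$ denotes the arc from $u$ to $v$. $\mathcal{T}_5$ is the family of $5$-vertex tournaments with no transitive subtournament on $4$ vertices; $\mathcal{T}_7$ is the family of $7$-vertex tournaments with no transitive subtournament on $5$ vertices; a tournament is $\mathcal{T}_k$-free ($k=5,7$) if it has no $k$-vertex subtournament isomorphic to a member of $\mathcal{T}_k$. For a vertex $z$ and $\ell\ge1$, $V_\ell(z)$ is the set of vertices $v$ such that the shortest directed path from $v$ to $z$ has length exactly $\ell-1$. For disjoint vertex sets $S,Z$, $Z$ in-dominates $S$ if for every $s\in S$ there is $z'\in Z$ with $s\to z'$; $Z$ 2-in-dominates $S$ if some $Z'\subseteq Z$ with $|Z'|\le 2$ in-dominates $S$. -}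

module Defs where

open import Data.Nat using (ℕ; zero; suc; _<_; _≤_; _∸_)
open import Data.Fin using (Fin) renaming (_<_ to _<ᶠ_)
open import Data.Bool using (Bool; true; false; not)
open import Data.List using (List; length)
open import Data.List.Relation.Unary.All using (All)
open import Data.List.Relation.Unary.Any using (Any)
open import Data.Product using (Σ; ∃; _×_; _,_)
open import Data.Sum using (_⊎_)
open import Relation.Nullary using (¬_)
open import Relation.Binary.PropositionalEquality using (_≡_; _≢_)
open import Function.Definitions using (Injective)

-- A tournament on the vertex set Fin n: arc u v ≡ true means u → v.
record Tournament (n : ℕ) : Set where
  field
    arc     : Fin n → Fin n → Bool
    irrefl  : ∀ u → arc u u ≡ false
    complete-antisym : ∀ u v → u ≢ v → arc u v ≡ not (arc v u)

open Tournament public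

_∶_⇒_ : ∀ {n} → Tournament n → Fin n → Fin n → Set
T ∶ u ⇒ v = arc T u v ≡ true

HasTransitive : ∀ {n} → Tournament n → ℕ → Set
HasTransitive {n} T m =
  Σ (Fin m → Fin n) λ f → Injective _≡_ _≡_ f × (∀ i j → i <ᶠ j → T ∶ f i ⇒ f j)

InT5 : Tournament 5 → Set
InT5 S = ¬ HasTransitive S 4

InT7 : Tournament 7 → Set
InT7 S = ¬ HasTransitive S 5

EmbedsIn : ∀ {n k} → Tournament n → (Fin n → Set) → Tournament k → Set
EmbedsIn {n} {k} T P S =
  Σ (Fin k → Fin n) λ g → Injective _≡_ _≡_ g × (∀ i → P (g i))
    × (∀ i j → arc T (g i) (g j) ≡ arc S i j)

T5-free-on : ∀ {n} → Tournament n → (Fin n → Set) → Set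
T5-free-on T P = ∀ (S : Tournament 5) → InT5 S → ¬ EmbedsIn T P S

T7-free : ∀ {n} → Tournament n → Set
T7-free T = ∀ (S : Tournament 7) → InT7 S → ¬ EmbedsIn T (λ _ → ⊤') S
  where
  open import Data.Unit using () renaming (⊤ to ⊤')

data Walk {n} (T : Tournament n) : Fin n → Fin n → ℕ → Set where
  here : ∀ {u} → Walk T u u zero
  step : ∀ {u w v k} → T ∶ u ⇒ w → Walk T w v k → Walk T u v (suc k)

Dist : ∀ {n} → Tournament n → Fin n → Fin n → ℕ → Set
Dist T v z d = Walk T v z d × (∀ m → m < d → ¬ Walk T v z m)

-- V_ℓ(z) (for ℓ ≥ 1): shortest path from v to z has length ℓ - 1.
V : ∀ {n} → Tournament n → ℕ → Fin n → Fin n → Set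
V T ℓ z v = Dist T v z (ℓ ∸ 1)

InDominates : ∀ {n} → Tournament n → (Fin n → Set) → (Fin n → Set) → Set
InDominates T Z S = ∀ s → S s → ∃ λ z′ → Z z′ × T ∶ s ⇒ z′

TwoInDominates : ∀ {n} → Tournament n → (Fin n → Set) → (Fin n → Set) → Set
TwoInDominates T Z S =
  Σ (List _) λ Z′ → length Z′ ≤ 2 × All Z Z′
    × InDominates T (λ x → Any (x ≡_) Z′) S

module Submission where

-- Let the five vertices of H ⊆ V_i(z) (i ≥ 3) span a member of 𝒯₅, and let
-- z₁, z₂ ∈ V_{i-1}(z) in-dominate V_i(z).  We derive a contradiction.
--
-- Key claim (dominator-beats-three): every b ∈ V_{i-1}(z) dominates three
-- vertices of H.  Indeed b has an out-neighbour w ∈ V_{i-2}(z), and w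
-- dominates all of H (a vertex of H beating or equal to w would be too close
-- to z).  By 𝒯₇-freeness the seven vertices H ∪ {w, b} contain a transitive
-- 5-set; since H has no transitive 4-set, the purely combinatorial lemma
-- leader-beats shows that this 5-set starts with b, then w, then three
-- vertices of H, all dominated by b.
--
-- Counting (dominated-by-two): every vertex of H beats z₁ or z₂, so the
-- out-neighbours of z₁ and of z₂ in H are disjoint, and 3 + 3 > 5 = |H|.

open import Defs
open import Data.Nat using (ℕ; zero; suc; _+_; _<_; _≤_; _≥_; _∸_; s≤s; z≤n)
open import Data.Nat.Properties using (1+n≰n; n<1+n; <⇒≤; m<n⇒m<1+n)
open import Data.Fin using (Fin; zero; suc; punchIn; splitAt; join)
  renaming (_<_ to _<ᶠ_)
open import Data.Fin.Properties
  using (_≟_; <-cmp; ≤∧≢⇒<; punchIn-mono-≤; punchIn-injective; punchInᵢ≢i;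
         any?; injective⇒≤; join-splitAt)
  renaming (<⇒≢ to <ᶠ⇒≢)
open import Data.Bool using (not)
open import Data.Bool.Properties using (¬-not)
open import Data.List using ([]; _∷_)
open import Data.List.Relation.Unary.All using (_∷_)
open import Data.List.Relation.Unary.Any using (here; there)
open import Data.Vec.Functional using () renaming (_∷_ to _∷ᶠ_)
open import Data.Product using (∃; ∃₂; _×_; _,_; proj₁; proj₂)
open import Data.Sum using (_⊎_; inj₁; inj₂; [_,_]′; map₂)
open import Data.Empty using (⊥-elim)
open import Data.Unit using (tt)
open import Level using (0ℓ)
open import Relation.Nullary using (¬_; yes; no)
open import Relation.Unary using (Pred; _∈_; _∉_; _⊆_; _∩_; _∪_; ｛_｝)
open import Relation.Binary.Definitions using (tri<; tri≈; tri>)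
open import Relation.Binary.PropositionalEquality
open import Function using (_∘′_)
open import Function.Definitions using (Injective)

private
  variable
    n m k : ℕ

Image : (Fin k → Fin n) → Pred (Fin n) 0ℓ
Image g x = ∃ λ s → g s ≡ x

Out : Tournament n → Fin n → Pred (Fin n) 0ℓ
Out T b x = T ∶ b ⇒ x

module _ (T : Tournament n) where

  loopless : ∀ {x y} → T ∶ x ⇒ y → x ≢ y
  loopless {x} x⇒x refl with trans (sym x⇒x) (irrefl T x)
  ... | ()

  asym : ∀ {x y} → T ∶ x ⇒ y → ¬ T ∶ y ⇒ x
  asym {x} {y} x⇒y y⇒x
    with trans (sym x⇒y) (trans (complete-antisym T x y (loopless x⇒y)) (cong not y⇒x))
  ... | ()

  total : ∀ {x y} → x ≢ y → ¬ T ∶ x ⇒ y → T ∶ y ⇒ x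
  total {x} {y} x≢y x⇏y =
    trans (complete-antisym T y x (x≢y ∘′ sym)) (cong not (¬-not x⇏y))

  two-step : ∀ {w v y} → T ∶ w ⇒ v → T ∶ v ⇒ y → w ≢ y
  two-step w⇒v v⇒y refl = asym w⇒v v⇒y

  ordered⇒injective : (f : Fin k → Fin n) → (∀ {i j} → i <ᶠ j → T ∶ f i ⇒ f j)
                    → Injective _≡_ _≡_ f
  ordered⇒injective f ord {i} {j} fi≡fj with <-cmp i j
  ... | tri< i<j _ _ = ⊥-elim (loopless (ord i<j) fi≡fj)
  ... | tri≈ _ i≡j _ = i≡j
  ... | tri> _ _ j<i = ⊥-elim (loopless (ord j<i) (sym fi≡fj))

record TransitiveIn (T : Tournament n) (P : Pred (Fin n) 0ℓ) (k : ℕ) : Set where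
  field
    vertex  : Fin k → Fin n
    inside  : ∀ i → vertex i ∈ P
    ordered : ∀ {i j} → i <ᶠ j → T ∶ vertex i ⇒ vertex j

  injective : Injective _≡_ _≡_ vertex
  injective = ordered⇒injective T vertex ordered

open TransitiveIn

residue : ∀ {H : Pred (Fin n) 0ℓ} {b w y} → y ∈ (｛ b ｝ ∪ ｛ w ｝ ∪ H) → b ≢ y → w ≢ y → y ∈ H
residue (inj₁ b≡y)        b≢y _   = ⊥-elim (b≢y b≡y)
residue (inj₂ (inj₁ w≡y)) _   w≢y = ⊥-elim (w≢y w≡y)
residue (inj₂ (inj₂ y∈H)) _   _   = y∈H

module _ {T : Tournament n} where

  refine : ∀ {P Q} (t : TransitiveIn T P k) → (∀ i → vertex t i ∈ Q) → TransitiveIn T Q k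
  refine t inQ = record { vertex = vertex t ; inside = inQ ; ordered = ordered t }

  weaken : ∀ {P Q} → P ⊆ Q → TransitiveIn T P k → TransitiveIn T Q k
  weaken P⊆Q t = refine t (λ i → P⊆Q (inside t i))

  tail : ∀ {P} (t : TransitiveIn T P (suc k))
       → TransitiveIn T (P ∩ Out T (vertex t zero)) k
  tail t = record
    { vertex  = λ i → vertex t (suc i)
    ; inside  = λ i → inside t (suc i) , ordered t (s≤s z≤n)
    ; ordered = λ i<j → ordered t (s≤s i<j)
    }

  led-into : ∀ {P Q} (t : TransitiveIn T P (suc k)) → vertex t zero ∈ Q
           → P ∩ Out T (vertex t zero) ⊆ Q → TransitiveIn T Q (suc k)
  led-into {Q = Q} t first rest = refine t inQ
    where
    inQ : ∀ i → vertex t i ∈ Q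
    inQ zero    = first
    inQ (suc i) = rest (inside t (suc i) , ordered t (s≤s z≤n))

  without : ∀ {P} (j : Fin (suc k)) (t : TransitiveIn T P (suc k)) → TransitiveIn T P k
  without j t = record
    { vertex  = λ a → vertex t (punchIn j a)
    ; inside  = λ a → inside t (punchIn j a)
    ; ordered = λ {a} {b} a<b → ordered t (≤∧≢⇒< (punchIn-mono-≤ j a b (<⇒≤ a<b))
                                                 (<ᶠ⇒≢ a<b ∘′ punchIn-injective j a b))
    }

  -- Removing a single vertex x from the ambient set costs at most one vertex:
  -- delete the position of x if it occurs, and an arbitrary one otherwise.
  delete : ∀ {P} (x : Fin n) → TransitiveIn T (｛ x ｝ ∪ P) (suc k) → TransitiveIn T P k
  delete {P = P} x t with any? (λ j → x ≟ vertex t j)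
  ... | yes (j , x≡tj) = refine (without j t) inP
    where
    inP : ∀ a → vertex t (punchIn j a) ∈ P
    inP a with inside t (punchIn j a)
    ... | inj₁ x≡ta = ⊥-elim (punchInᵢ≢i j a (injective t (trans (sym x≡ta) x≡tj)))
    ... | inj₂ p    = p
  ... | no absent = refine (without zero t) inP
    where
    inP : ∀ a → vertex t (suc a) ∈ P
    inP a with inside t (suc a)
    ... | inj₁ x≡ta = ⊥-elim (absent (suc a , x≡ta))
    ... | inj₂ p    = p

  -- If H contains no transitive (k+1)-set, then a
  -- transitive (k+2)-set inside {b} ∪ {w} ∪ H must begin with b and then w,
  -- so b dominates a transitive k-set of H.
  leader-beats : ∀ {k} {H : Pred (Fin n) 0ℓ} {b w} → H ⊆ Out T w → T ∶ b ⇒ w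
               → ¬ TransitiveIn T H (suc k)
               → TransitiveIn T (｛ b ｝ ∪ ｛ w ｝ ∪ H) (suc (suc k))
               → TransitiveIn T (H ∩ Out T b) k
  leader-beats {k} {H} {b} {w} w⇒H b⇒w noTT t with inside t zero
  -- t starts with b: what follows is dominated by b and must start with w.
  ... | inj₁ b≡t₀ =
    after-b (weaken (λ (p , t₀⇒y) → p , subst (λ v → T ∶ v ⇒ _) (sym b≡t₀) t₀⇒y) (tail t))
    where
    after-b : TransitiveIn T ((｛ b ｝ ∪ ｛ w ｝ ∪ H) ∩ Out T b) (suc k)
            → TransitiveIn T (H ∩ Out T b) k
    after-b u with proj₁ (inside u zero)
    ... | inj₁ b≡u₀        = ⊥-elim (loopless T (proj₂ (inside u zero)) b≡u₀)
    -- u starts with w: the rest of u is dominated by b and w, so lies in H.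
    ... | inj₂ (inj₁ w≡u₀) =
      weaken (λ ((p , b⇒y) , u₀⇒y) →
                residue {H = H} p (loopless T b⇒y)
                                  (λ w≡y → loopless T u₀⇒y (trans (sym w≡u₀) w≡y)) , b⇒y)
             (tail u)
    -- u starts in H: then w does not occur in u, so u lies in H.
    ... | inj₂ (inj₂ u₀∈H) =
      ⊥-elim (noTT (led-into u u₀∈H (λ ((p , b⇒y) , u₀⇒y) →
                      residue {H = H} p (loopless T b⇒y) (two-step T (w⇒H u₀∈H) u₀⇒y))))
  -- t starts with w: the rest of t is dominated by w, so lies in H.
  ... | inj₂ (inj₁ w≡t₀) =
    ⊥-elim (noTT (weaken (λ (p , t₀⇒y) →
      residue {H = H} p (λ b≡y → asym T b⇒w (subst₂ (T ∶_⇒_) (sym w≡t₀) (sym b≡y) t₀⇒y))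
                        (λ w≡y → loopless T t₀⇒y (trans (sym w≡t₀) w≡y)))
      (tail t)))
  -- t starts in H: then w does not occur in t, and deleting b leaves k + 1
  -- vertices of H.
  ... | inj₂ (inj₂ t₀∈H) =
    ⊥-elim (noTT (delete b (led-into t (inj₂ t₀∈H) (λ (p , t₀⇒y) →
                              drop-w p (two-step T (w⇒H t₀∈H) t₀⇒y)))))
    where
    drop-w : ∀ {y} → y ∈ (｛ b ｝ ∪ ｛ w ｝ ∪ H) → w ≢ y → y ∈ (｛ b ｝ ∪ H)
    drop-w (inj₁ b≡y)        _   = inj₁ b≡y
    drop-w (inj₂ (inj₁ w≡y)) w≢y = ⊥-elim (w≢y w≡y)
    drop-w (inj₂ (inj₂ y∈H)) _   = inj₂ y∈H

Copy : Tournament n → (Fin k → Fin n) → Tournament k → Set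
Copy T g S = ∀ i j → arc T (g i) (g j) ≡ arc S i j

from-copy : ∀ {T : Tournament n} {g : Fin k → Fin n} {S} → Copy T g S
          → HasTransitive S m → TransitiveIn T (Image g) m
from-copy {g = g} copy (f , _ , ord) = record
  { vertex  = λ i → g (f i)
  ; inside  = λ i → f i , refl
  ; ordered = λ {i} {j} i<j → trans (copy (f i) (f j)) (ord i j i<j)
  }

index : ∀ {T : Tournament n} {h : Fin m → Fin n} → TransitiveIn T (Image h) k → Fin k → Fin m
index t i = proj₁ (inside t i)

index-injective : ∀ {T : Tournament n} {h : Fin m → Fin n} (t : TransitiveIn T (Image h) k)
                → Injective _≡_ _≡_ (index t)
index-injective {h = h} t {i} {j} same =
  injective t (trans (sym (proj₂ (inside t i))) (trans (cong h same) (proj₂ (inside t j))))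

to-copy : ∀ {T : Tournament n} {h : Fin k → Fin n} {S} → Copy T h S
        → TransitiveIn T (Image h) m → HasTransitive S m
to-copy {T = T} {h} {S} copy t = index t , index-injective t , λ _ _ → ord
  where
  ord : ∀ {a b} → a <ᶠ b → S ∶ index t a ⇒ index t b
  ord {a} {b} a<b =
    trans (sym (copy (index t a) (index t b)))
          (subst₂ (T ∶_⇒_) (sym (proj₂ (inside t a))) (sym (proj₂ (inside t b))) (ordered t a<b))

induced : (T : Tournament n) (g : Fin k → Fin n) → Injective _≡_ _≡_ g → Tournament k
induced T g g-inj = record
  { arc              = λ i j → arc T (g i) (g j)
  ; irrefl           = λ i → irrefl T (g i)
  ; complete-antisym = λ i j i≢j → complete-antisym T (g i) (g j) (i≢j ∘′ g-inj)
  }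

seven-transitive : ∀ {T : Tournament n} → T7-free T → (g : Fin 7 → Fin n)
                 → Injective _≡_ _≡_ g → ¬ ¬ TransitiveIn T (Image g) 5
seven-transitive {T = T} free g g-inj none =
  free (induced T g g-inj) (λ tt₅ → none (from-copy {S = induced T g g-inj} (λ _ _ → refl) tt₅))
       (g , g-inj , (λ _ → tt) , λ _ _ → refl)

image-∷ : ∀ {x} {g : Fin k → Fin n} → Image (x ∷ᶠ g) ⊆ ｛ x ｝ ∪ Image g
image-∷ (zero  , x≡y)  = inj₁ x≡y
image-∷ (suc s , gs≡y) = inj₂ (s , gs≡y)

∷-injective : ∀ {x} {g : Fin k → Fin n} → x ∉ Image g → Injective _≡_ _≡_ g
            → Injective _≡_ _≡_ (x ∷ᶠ g)
∷-injective x∉g g-inj {zero}  {zero}  _     = refl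
∷-injective x∉g g-inj {zero}  {suc j} x≡gj  = ⊥-elim (x∉g (j , sym x≡gj))
∷-injective x∉g g-inj {suc i} {zero}  gi≡x  = ⊥-elim (x∉g (i , gi≡x))
∷-injective x∉g g-inj {suc i} {suc j} gi≡gj = cong suc (g-inj gi≡gj)

closer⇒distinct : ∀ {T : Tournament n} {x y z d} → Dist T x z d → Walk T y z m → m < d → x ≢ y
closer⇒distinct (_ , shortest) walk m<d refl = shortest _ m<d walk

closer⇒not-beaten : ∀ {T : Tournament n} {x y z d} → Dist T x z d → Walk T y z m
                  → suc m < d → ¬ T ∶ x ⇒ y
closer⇒not-beaten (_ , shortest) walk m+1<d x⇒y = shortest _ m+1<d (step x⇒y walk)

next-layer-dominates : ∀ {T : Tournament n} {x w z} → Dist T x z (suc (suc k)) → Walk T w z k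
                     → T ∶ w ⇒ x
next-layer-dominates {T = T} far walk =
  total T (closer⇒distinct far walk (m<n⇒m<1+n (n<1+n _))) (closer⇒not-beaten far walk (n<1+n _))

dominator-beats-three : ∀ {T : Tournament n} {z b} {h : Fin 5 → Fin n} → T7-free T
                      → Injective _≡_ _≡_ h → ¬ TransitiveIn T (Image h) 4
                      → (∀ s → Dist T (h s) z (suc (suc k))) → Walk T b z (suc k)
                      → ¬ ¬ TransitiveIn T (Image h ∩ Out T b) 3
dominator-beats-three {T = T} {b = b} {h} free h-inj noTT₄ far (step {w = w} b⇒w w-walk) none =
  seven-transitive free (b ∷ᶠ w ∷ᶠ h) (∷-injective b∉wh (∷-injective w∉h h-inj))
    (λ t → none (leader-beats w⇒h b⇒w noTT₄ (weaken (map₂ image-∷ ∘′ image-∷) t)))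
  where
  w⇒h : Image h ⊆ Out T w
  w⇒h (s , refl) = next-layer-dominates (far s) w-walk

  w∉h : w ∉ Image h
  w∉h (s , hs≡w) = closer⇒distinct (far s) w-walk (m<n⇒m<1+n (n<1+n _)) hs≡w

  b∉wh : b ∉ Image (w ∷ᶠ h)
  b∉wh b∈wh with image-∷ b∈wh
  ... | inj₁ w≡b         = loopless T b⇒w (sym w≡b)
  ... | inj₂ (s , hs≡b) = closer⇒distinct (far s) (step b⇒w w-walk) (n<1+n _) hs≡b

disjoint-families : ∀ {a b} (u : Fin a → Fin m) (v : Fin b → Fin m)
                  → Injective _≡_ _≡_ u → Injective _≡_ _≡_ v → (∀ i j → u i ≢ v j)
                  → a + b ≤ m
disjoint-families {a = a} {b} u v u-inj v-inj disjoint =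
  injective⇒≤ {f = [ u , v ]′ ∘′ splitAt a} (λ same → splitAt-injective (both-injective same))
  where
  both-injective : ∀ {p q} → [ u , v ]′ p ≡ [ u , v ]′ q → p ≡ q
  both-injective {inj₁ i} {inj₁ j} same = cong inj₁ (u-inj same)
  both-injective {inj₁ i} {inj₂ j} same = ⊥-elim (disjoint i j same)
  both-injective {inj₂ i} {inj₁ j} same = ⊥-elim (disjoint j i (sym same))
  both-injective {inj₂ i} {inj₂ j} same = cong inj₂ (v-inj same)

  splitAt-injective : ∀ {i j} → splitAt a i ≡ splitAt a j → i ≡ j
  splitAt-injective {i} {j} same =
    trans (sym (join-splitAt a b i)) (trans (cong (join a b) same) (join-splitAt a b j))

-- Counting: if every h s beats z₁ or z₂, then no vertex is dominated by both
-- z₁ and z₂, so transitive sets of their out-neighbours inside the image of h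
-- have total size at most m.
dominated-by-two : ∀ {T : Tournament n} {h : Fin m → Fin n} {z₁ z₂ a b}
                 → (∀ s → T ∶ h s ⇒ z₁ ⊎ T ∶ h s ⇒ z₂)
                 → TransitiveIn T (Image h ∩ Out T z₁) a → TransitiveIn T (Image h ∩ Out T z₂) b
                 → a + b ≤ m
dominated-by-two {T = T} {h} {z₁} {z₂} dom t₁ t₂ =
  disjoint-families (index u₁) (index u₂) (index-injective u₁) (index-injective u₂) disjoint
  where
  u₁ : TransitiveIn T (Image h) _
  u₁ = weaken proj₁ t₁
  u₂ : TransitiveIn T (Image h) _
  u₂ = weaken proj₁ t₂

  both-dominate : ∀ i j → index u₁ i ≡ index u₂ j
                → T ∶ z₁ ⇒ h (index u₁ i) × T ∶ z₂ ⇒ h (index u₁ i)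
  both-dominate i j same =
    subst (T ∶ z₁ ⇒_) (sym (proj₂ (inside u₁ i))) (proj₂ (inside t₁ i)) ,
    subst (T ∶ z₂ ⇒_) (sym (trans (cong h same) (proj₂ (inside u₂ j)))) (proj₂ (inside t₂ j))

  disjoint : ∀ i j → index u₁ i ≢ index u₂ j
  disjoint i j same with both-dominate i j same
  ... | z₁⇒x , z₂⇒x = [ asym T z₁⇒x , asym T z₂⇒x ]′ (dom (index u₁ i))

-- A set Z′ of at most two vertices in-dominating a nonempty set S can be
-- presented as a pair z₁, z₂ (equal if |Z′| = 1).
dominating-pair : ∀ {T : Tournament n} {Z S : Pred (Fin n) 0ℓ} {s₀} → s₀ ∈ S
                → TwoInDominates T Z S
                → ∃₂ λ z₁ z₂ → z₁ ∈ Z × z₂ ∈ Z × (∀ {s} → s ∈ S → T ∶ s ⇒ z₁ ⊎ T ∶ s ⇒ z₂)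
dominating-pair s₀∈S ([] , _ , _ , dom) with dom _ s₀∈S
... | _ , () , _
dominating-pair {T = T} {S = S} _ (z₁ ∷ [] , _ , z₁∈Z ∷ _ , dom) = z₁ , z₁ , z₁∈Z , z₁∈Z , beats
  where
  beats : ∀ {s} → s ∈ S → T ∶ s ⇒ z₁ ⊎ T ∶ s ⇒ z₁
  beats s∈S with dom _ s∈S
  ... | _ , here refl , s⇒z₁ = inj₁ s⇒z₁
dominating-pair {T = T} {S = S} _ (z₁ ∷ z₂ ∷ [] , _ , z₁∈Z ∷ z₂∈Z ∷ _ , dom) =
  z₁ , z₂ , z₁∈Z , z₂∈Z , beats
  where
  beats : ∀ {s} → s ∈ S → T ∶ s ⇒ z₁ ⊎ T ∶ s ⇒ z₂
  beats s∈S with dom _ s∈S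
  ... | _ , here refl         , s⇒z₁ = inj₁ s⇒z₁
  ... | _ , there (here refl) , s⇒z₂ = inj₂ s⇒z₂
dominating-pair _ (_ ∷ _ ∷ _ ∷ _ , s≤s (s≤s ()) , _)

lemma6 : ∀ {n} (T : Tournament n) → T7-free T → (z : Fin n) → (i : ℕ) → i ≥ 3
    → TwoInDominates T (V T (i ∸ 1) z) (V T i z)
    → T5-free-on T (V T i z)
lemma6 T free z (suc (suc (suc k))) (s≤s (s≤s (s≤s _))) two S inT₅ (h , h-inj , far , copy)
  with dominating-pair {T = T} {Z = V T (suc (suc k)) z} (far zero) two
... | z₁ , z₂ , (walk₁ , _) , (walk₂ , _) , dom =
  beats-three walk₁ λ t₁ → beats-three walk₂ λ t₂ →
    1+n≰n (dominated-by-two (λ s → dom (far s)) t₁ t₂)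
  where
  beats-three : ∀ {b} → Walk T b z (suc k) → ¬ ¬ TransitiveIn T (Image h ∩ Out T b) 3
  beats-three = dominator-beats-three free h-inj noTT₄ far
    where
    noTT₄ : ¬ TransitiveIn T (Image h) 4
    noTT₄ t = inT₅ (to-copy {h = h} {S = S} copy t)
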